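{- Let $D_1$ and $D_2$ be two vertex disjoint digraphs with Hamiltonian cycles $C_1=(x_0,x_1,\ldots,x_{n-1},x_0)$ and $C_2=(y_0,y_1,\ldots,y_{m-1},y_0)$, respectively, and let $D\in D_1\oplus D_2$. If $D$ is strong and contains no good pair (with respect to $C_1$ and $C_2$), then for each vertex $v\in V(D)$ and each integer $t$ with $m_1+2\le t\le n+m$, there is a directed cycle of length $t$ in $D$ passing through $v$, where $m_1=\min\{n,m\}$.
   Context: All paths and cycles are directed. Generalized sum: for pairwise vertex disjoint digraphs $D_1,\ldots,D_k$, $\oplus_{i=1}^k D_i$ is the set of all digraphs $D$ with $V(D)=\bigcup_i V(D_i)$, such that the subdigraph of $D$ induced by $V(D_i)$ is $D_i$ for each $i$, and such that between each pair of vertices lying in different $D_i$'s there is exactly one arc (in one direction). A digraph is strong if for any two distinct vertices $u,v$ there are a directed $uv$-path and a directed $vu$-path. Good pair: given two vertex disjoint cycles $C_1=(x_0,\ldots,x_{n-1},x_0)$ and $C_2=(y_0,\ldots,y_{m-1},y_0)$ in $D$, a good pair is a pair of arcs $x_s\to y_r$ and $y_{r-1}\to x_{s+1}$ of $D$ for some $s\in\{0,\ldots,n-1\}$, $r\in\{0,\ldots,m-1\}$ (subscripts modulo $n$ and $m$ respectively); $D$ "contains no good pair" means no such pair of arcs exists between $C_1$ and $C_2$. -}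

module Defs where

open import Data.Nat using (ℕ; zero; suc; _+_; _%_)
open import Data.Nat.DivMod using (m%n<n)
open import Data.Fin using (Fin; toℕ; fromℕ<; fromℕ; inject₁)
open import Data.Sum using (_⊎_; inj₁; inj₂)
open import Data.Product using (Σ; ∃; _×_)
open import Relation.Binary.PropositionalEquality using (_≡_)
open import Relation.Nullary using (¬_)
open import Function.Definitions using (Injective)

sucMod : ∀ {n} → Fin n → Fin n
sucMod {suc n} i = fromℕ< (m%n<n (suc (toℕ i)) (suc n))

predMod : ∀ {n} → Fin n → Fin n
predMod {suc n} i = fromℕ< (m%n<n (toℕ i + n) (suc n))

-- A digraph on vertex set V: an arc relation without loops
-- (multiple arcs are impossible for a relation).
Loopless : ∀ {V : Set} → (V → V → Set) → Set
Loopless {V} A = ∀ (v : V) → ¬ A v v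

Path : ∀ {V : Set} → (V → V → Set) → V → V → Set
Path {V} A u v =
  Σ ℕ λ k → Σ (Fin (suc k) → V) λ p →
    Injective _≡_ _≡_ p × p Fin.zero ≡ u × p (fromℕ k) ≡ v ×
    (∀ (i : Fin k) → A (p (inject₁ i)) (p (Fin.suc i)))

Strong : ∀ {V : Set} → (V → V → Set) → Set
Strong {V} A = ∀ (u v : V) → ¬ u ≡ v → Path A u v × Path A v u

CycleThrough : ∀ {V : Set} → (V → V → Set) → ℕ → V → Set
CycleThrough {V} A t v =
  Σ (Fin t → V) λ c →
    Injective _≡_ _≡_ c × (∀ (i : Fin t) → A (c i) (c (sucMod i))) ×
    ∃ λ (i : Fin t) → c i ≡ v

-- Setting: D has vertex set Fin n ⊎ Fin m, with x_i = inj₁ i and y_j = inj₂ j.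
-- C₁ = (x_0,…,x_{n-1},x_0) is a Hamiltonian cycle of D₁ = D[{x_i}]
HamCycle₁ : ∀ {n m : ℕ} → (Fin n ⊎ Fin m → Fin n ⊎ Fin m → Set) → Set
HamCycle₁ {n} {m} A = ∀ (i : Fin n) → A (inj₁ i) (inj₁ (sucMod i))

HamCycle₂ : ∀ {n m : ℕ} → (Fin n ⊎ Fin m → Fin n ⊎ Fin m → Set) → Set
HamCycle₂ {n} {m} A = ∀ (j : Fin m) → A (inj₂ j) (inj₂ (sucMod j))

-- D ∈ D₁ ⊕ D₂: exactly one arc between x_i and y_j
GenSum : ∀ {n m : ℕ} → (Fin n ⊎ Fin m → Fin n ⊎ Fin m → Set) → Set
GenSum {n} {m} A = ∀ (i : Fin n) (j : Fin m) →
  (A (inj₁ i) (inj₂ j) ⊎ A (inj₂ j) (inj₁ i)) × ¬ (A (inj₁ i) (inj₂ j) × A (inj₂ j) (inj₁ i))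

GoodPair : ∀ {n m : ℕ} → (Fin n ⊎ Fin m → Fin n ⊎ Fin m → Set) → Set
GoodPair {n} {m} A = Σ (Fin n) λ s → Σ (Fin m) λ r →
  A (inj₁ s) (inj₂ r) × A (inj₂ (predMod r)) (inj₁ (sucMod s))

module Submission where

-- Without a good pair, an arc x_s → y_{r+1} forces x_{s+1} → y_r, and an arc y_r → x_{s+1}
-- forces y_{r+1} → x_s; iterating the latter n m − 1 times also reverses it.  Call
-- x_a → y_b → x_{a+1} a detour.  Strong connectivity gives arcs in both directions between C₁
-- and C₂, and scanning C₁ between an in- and an out-neighbour of one y_b yields a detour; by the
-- two rules it propagates to x_{a+k} → y_{b−k} → x_{a+k+1} for every k, so every vertex lies on
-- a detour.  From a detour, running up C₂ for a multiple of n steps and then zigzagging between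
-- C₁ and C₂ p < n times gives cycles through x_a and y_b of every length from n + 1 to n + m.
-- When m < n the roles of C₁ and C₂ are exchanged.

open import Defs
open import Data.Empty using (⊥; ⊥-elim)
open import Data.Fin using (Fin; toℕ; fromℕ<; fromℕ; inject₁) renaming (zero to fzero; suc to fsuc)
open import Data.Fin.Properties using (toℕ-fromℕ<; toℕ-injective; toℕ<n; fromℕ<-cong; fromℕ<-toℕ)
open import Data.List using (List; []; _∷_; _++_; length; applyUpTo)
open import Data.List.Membership.Propositional using (_∈_)
open import Data.List.Membership.Propositional.Properties
  using (∈-++⁺ʳ; ∈-++⁻; ∈-applyUpTo⁺; ∈-applyUpTo⁻)
open import Data.List.Properties using (length-++; length-applyUpTo)
open import Data.List.Relation.Binary.Disjoint.Propositional using (Disjoint)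
open import Data.List.Relation.Unary.All using (_∷_) renaming (tabulate to tabulateAll)
open import Data.List.Relation.Unary.AllPairs using ([]; _∷_)
open import Data.List.Relation.Unary.Any using (here; there)
open import Data.List.Relation.Unary.Unique.Propositional using (Unique)
open import Data.List.Relation.Unary.Unique.Propositional.Properties
  using (Unique[x∷xs]⇒x∉xs; applyUpTo⁺₁; ++⁺)
open import Data.Nat
open import Data.Nat.DivMod
open import Data.Nat.Properties
open import Data.Nat.Tactic.RingSolver using (solve-∀)
open import Data.Product using (∃; ∃₂; _×_; _,_; proj₁; proj₂)
open import Data.Sum using (_⊎_; inj₁; inj₂; swap; [_,_]′)
open import Data.Sum.Properties using (inj₁-injective; inj₂-injective; swap-involutive)
open import Data.Unit using (⊤; tt)
open import Function using (_∘_)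
open import Relation.Binary.Construct.Closure.ReflexiveTransitive using (Star; ε; _◅_; _◅◅_)
open import Relation.Binary.PropositionalEquality
open import Relation.Nullary using (¬_; ¬?; yes; no; contradiction)
open import Relation.Unary using (Decidable)

-- Walks and cycles

module _ {V : Set} {A : V → V → Set} where

  -- the final vertex is omitted, so that a closed walk lists each of its vertices once
  verts : ∀ {u v} → Star A u v → List V
  verts ε = []
  verts (_◅_ {u} _ W) = u ∷ verts W

  verts-◅◅ : ∀ {u v w} (W : Star A u v) (W′ : Star A v w) →
             verts (W ◅◅ W′) ≡ verts W ++ verts W′
  verts-◅◅ ε W′ = refl
  verts-◅◅ (_◅_ {u} _ W) W′ = cong (u ∷_) (verts-◅◅ W W′)

  along : ∀ {v} (f : ℕ → V) → (∀ i → A (f i) (f (suc i))) → ∀ k → A (f k) v → Star A (f 0) v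
  along f arc zero last = last ◅ ε
  along f arc (suc k) last = arc 0 ◅ along (f ∘ suc) (arc ∘ suc) k last

  verts-along : ∀ {v} (f : ℕ → V) (arc : ∀ i → A (f i) (f (suc i))) k (last : A (f k) v) →
                verts (along f arc k last) ≡ applyUpTo f (suc k)
  verts-along f arc zero last = refl
  verts-along f arc (suc k) last = cong (f 0 ∷_) (verts-along (f ∘ suc) (arc ∘ suc) k last)

  ladder : (u w : ℕ → V) → ∀ k → (∀ i → i < k → A (u i) (w i)) →
           (∀ i → i < k → A (w i) (u (suc i))) → Star A (u 0) (u k)
  ladder u w zero rung₁ rung₂ = ε
  ladder u w (suc k) rung₁ rung₂ = rung₁ 0 z<s ◅ rung₂ 0 z<s ◅
    ladder (u ∘ suc) (w ∘ suc) k (λ i → rung₁ (suc i) ∘ s<s) (λ i → rung₂ (suc i) ∘ s<s)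

  ∈-ladder⁻ : ∀ {u w} k {rung₁ rung₂ v} → v ∈ verts (ladder u w k rung₁ rung₂) →
              (∃ λ i → i < k × v ≡ u i) ⊎ (∃ λ i → i < k × v ≡ w i)
  ∈-ladder⁻ (suc k) (here refl) = inj₁ (0 , z<s , refl)
  ∈-ladder⁻ (suc k) (there (here refl)) = inj₂ (0 , z<s , refl)
  ∈-ladder⁻ (suc k) (there (there v∈)) with ∈-ladder⁻ k v∈
  ... | inj₁ (i , i<k , refl) = inj₁ (suc i , s<s i<k , refl)
  ... | inj₂ (i , i<k , refl) = inj₂ (suc i , s<s i<k , refl)

  length-ladder : ∀ {u w} k {rung₁ rung₂} → length (verts (ladder u w k rung₁ rung₂)) ≡ k + k
  length-ladder zero = refl
  length-ladder (suc k) = cong suc (trans (cong suc (length-ladder k)) (sym (+-suc k k)))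

  ladder-unique : ∀ {u w} k {rung₁ rung₂} →
                  (∀ {i i′} → i < k → i′ < k → u i ≡ u i′ → i ≡ i′) →
                  (∀ {i i′} → i < k → i′ < k → w i ≡ w i′ → i ≡ i′) →
                  (∀ i i′ → u i ≢ w i′) →
                  Unique (verts (ladder u w k rung₁ rung₂))
  ladder-unique zero _ _ _ = []
  ladder-unique {u} {w} (suc k) u-inj w-inj u≢w =
    (u≢w 0 0 ∷ tabulateAll u₀∉) ∷ tabulateAll w₀∉ ∷
    ladder-unique k (λ i<k i′<k → suc-injective ∘ u-inj (s<s i<k) (s<s i′<k))
                    (λ i<k i′<k → suc-injective ∘ w-inj (s<s i<k) (s<s i′<k))
                    (λ i i′ → u≢w (suc i) (suc i′))
    where
    u₀∉ : ∀ {v} → v ∈ verts (ladder (u ∘ suc) (w ∘ suc) k _ _) → u 0 ≢ v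
    u₀∉ v∈ with ∈-ladder⁻ k v∈
    ... | inj₁ (i , i<k , refl) = λ eq → 0≢1+n (u-inj z<s (s<s i<k) eq)
    ... | inj₂ (i , _ , refl) = u≢w 0 (suc i)
    w₀∉ : ∀ {v} → v ∈ verts (ladder (u ∘ suc) (w ∘ suc) k _ _) → w 0 ≢ v
    w₀∉ v∈ with ∈-ladder⁻ k v∈
    ... | inj₁ (i , _ , refl) = u≢w (suc i) 0 ∘ sym
    ... | inj₂ (i , i<k , refl) = λ eq → 0≢1+n (w-inj z<s (s<s i<k) eq)

  vertexAt : ∀ {u v} → Star A u v → ℕ → V
  vertexAt {u} ε _ = u
  vertexAt {u} (_ ◅ _) zero = u
  vertexAt (_ ◅ W) (suc k) = vertexAt W k

  vertexAt-arc : ∀ {u v k} (W : Star A u v) → k < length (verts W) →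
                 A (vertexAt W k) (vertexAt W (suc k))
  vertexAt-arc {k = zero} (e ◅ ε) _ = e
  vertexAt-arc {k = zero} (e ◅ (_ ◅ _)) _ = e
  vertexAt-arc {k = suc k} (_ ◅ W) (s<s k<) = vertexAt-arc W k<

  vertexAt-last : ∀ {u v} (W : Star A u v) → vertexAt W (length (verts W)) ≡ v
  vertexAt-last ε = refl
  vertexAt-last (_ ◅ W) = vertexAt-last W

  vertexAt-∈ : ∀ {u v k} (W : Star A u v) → k < length (verts W) → vertexAt W k ∈ verts W
  vertexAt-∈ {k = zero} (_ ◅ _) _ = here refl
  vertexAt-∈ {k = suc k} (_ ◅ W) (s<s k<) = there (vertexAt-∈ W k<)

  ∈⇒vertexAt : ∀ {u v z} (W : Star A u v) → z ∈ verts W →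
               ∃ λ k → k < length (verts W) × vertexAt W k ≡ z
  ∈⇒vertexAt (_ ◅ W) (here refl) = 0 , z<s , refl
  ∈⇒vertexAt (_ ◅ W) (there z∈) with ∈⇒vertexAt W z∈
  ... | k , k< , eq = suc k , s<s k< , eq

  vertexAt-injective : ∀ {u v k k′} (W : Star A u v) → Unique (verts W) →
                       k < length (verts W) → k′ < length (verts W) →
                       vertexAt W k ≡ vertexAt W k′ → k ≡ k′
  vertexAt-injective {k = zero} {zero} _ _ _ _ _ = refl
  vertexAt-injective {k = zero} {suc k′} (_ ◅ W) uniq _ (s<s k′<) eq =
    ⊥-elim (Unique[x∷xs]⇒x∉xs uniq (subst (_∈ verts W) (sym eq) (vertexAt-∈ W k′<)))
  vertexAt-injective {k = suc k} {zero} (_ ◅ W) uniq (s<s k<) _ eq =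
    ⊥-elim (Unique[x∷xs]⇒x∉xs uniq (subst (_∈ verts W) eq (vertexAt-∈ W k<)))
  vertexAt-injective {k = suc k} {suc k′} (_ ◅ W) (_ ∷ uniq) (s<s k<) (s<s k′<) eq =
    cong suc (vertexAt-injective W uniq k< k′< eq)

  closed-walk⇒cycle : ∀ {u z} (W : Star A u u) → Unique (verts W) → z ∈ verts W →
                      CycleThrough A (length (verts W)) z
  closed-walk⇒cycle {z = z} W@(_ ◅ _) uniq z∈W = c , c-injective , c-arc , position
    where
    T : ℕ
    T = length (verts W)
    c : Fin T → V
    c i = vertexAt W (toℕ i)
    c-injective : ∀ {i i′} → c i ≡ c i′ → i ≡ i′
    c-injective {i} {i′} = toℕ-injective ∘ vertexAt-injective W uniq (toℕ<n i) (toℕ<n i′)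
    wrap : ∀ {k} → k ≤ T → vertexAt W (k % T) ≡ vertexAt W k
    wrap k≤T with m≤n⇒m<n∨m≡n k≤T
    ... | inj₁ k<T = cong (vertexAt W) (m<n⇒m%n≡m k<T)
    ... | inj₂ refl = trans (cong (vertexAt W) (n%n≡0 T)) (sym (vertexAt-last W))
    c-arc : ∀ i → A (c i) (c (sucMod i))
    c-arc i = subst (A (c i)) (trans (sym (wrap (toℕ<n i))) (cong (vertexAt W) (sym toℕ-sucMod)))
                    (vertexAt-arc W (toℕ<n i))
      where
      toℕ-sucMod : toℕ (sucMod i) ≡ suc (toℕ i) % T
      toℕ-sucMod = toℕ-fromℕ< (m%n<n (suc (toℕ i)) T)
    position : ∃ λ i → c i ≡ z
    position with ∈⇒vertexAt W z∈W
    ... | k , k<T , eq = fromℕ< k<T , trans (cong (vertexAt W) (toℕ-fromℕ< k<T)) eq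

module _ {V : Set} {A : V → V → Set} {P : V → Set} (P? : Decidable P) where

  path-exits : ∀ {u v} → Path A u v → P u → ¬ P v → ∃₂ λ w w′ → P w × ¬ P w′ × A w w′
  path-exits (k , p , _ , refl , refl , arcs) = exits k p arcs
    where
    exits : ∀ k (p : Fin (suc k) → V) → (∀ i → A (p (inject₁ i)) (p (fsuc i))) →
            P (p fzero) → ¬ P (p (fromℕ k)) → ∃₂ λ w w′ → P w × ¬ P w′ × A w w′
    exits zero p _ Pp₀ ¬Pp₀ = ⊥-elim (¬Pp₀ Pp₀)
    exits (suc k) p arcs Pp₀ ¬Pp with P? (p (fsuc fzero))
    ... | yes Pp₁ = exits k (p ∘ fsuc) (arcs ∘ fsuc) Pp₁ ¬Pp
    ... | no ¬Pp₁ = p fzero , p (fsuc fzero) , Pp₀ , ¬Pp₁ , arcs fzero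

module _ {X Y : Set} {A : X ⊎ Y → X ⊎ Y → Set} where

  private
    IsInj₁ : X ⊎ Y → Set
    IsInj₁ (inj₁ _) = ⊤
    IsInj₁ (inj₂ _) = ⊥

    isInj₁? : Decidable IsInj₁
    isInj₁? (inj₁ _) = yes tt
    isInj₁? (inj₂ _) = no λ ()

  path-arc₁₂ : ∀ {i j} → Path A (inj₁ i) (inj₂ j) → ∃₂ λ i′ j′ → A (inj₁ i′) (inj₂ j′)
  path-arc₁₂ path with path-exits {A = A} isInj₁? path tt (λ ())
  ... | inj₁ i , inj₂ j , _ , _ , xy = i , j , xy
  ... | inj₁ _ , inj₁ _ , _ , ¬tt , _ = ⊥-elim (¬tt tt)

  path-arc₂₁ : ∀ {i j} → Path A (inj₂ j) (inj₁ i) → ∃₂ λ j′ i′ → A (inj₂ j′) (inj₁ i′)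
  path-arc₂₁ path with path-exits {A = A} (¬? ∘ isInj₁?) path (λ ()) (λ ¬tt → ¬tt tt)
  ... | inj₂ j , inj₁ i , _ , _ , yx = j , i , yx
  ... | inj₁ _ , _ , ¬tt , _ , _ = ⊥-elim (¬tt tt)
  ... | inj₂ _ , inj₂ _ , _ , ¬¬⊥ , _ = ⊥-elim (¬¬⊥ λ ())

swapped : ∀ {X Y : Set} → (X ⊎ Y → X ⊎ Y → Set) → Y ⊎ X → Y ⊎ X → Set
swapped A u w = A (swap u) (swap w)

swap-cycle : ∀ {X Y : Set} {A : X ⊎ Y → X ⊎ Y → Set} {t v} →
             CycleThrough (swapped A) t (swap v) → CycleThrough A t v
swap-cycle {v = v} (c , c-injective , c-arc , i , c[i]≡v) =
  swap ∘ c , c-injective ∘ swap-injective , c-arc , i , trans (cong swap c[i]≡v) (swap-involutive v)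
  where
  swap-injective : ∀ {u w} → swap u ≡ swap w → u ≡ w
  swap-injective {u} {w} eq = trans (sym (swap-involutive u)) (trans (cong swap eq) (swap-involutive w))

gen-sum-swap : ∀ {n m} {A : Fin n ⊎ Fin m → Fin n ⊎ Fin m → Set} → GenSum A → GenSum (swapped A)
gen-sum-swap gen-sum j i = swap (proj₁ (gen-sum i j)) , λ (yx , xy) → proj₂ (gen-sum i j) (xy , yx)

-- Residues

[m%d+n]%d≡[m+n]%d : ∀ m n d .{{_ : NonZero d}} → (m % d + n) % d ≡ (m + n) % d
[m%d+n]%d≡[m+n]%d m n d = begin
  (m % d + n) % d           ≡⟨ %-distribˡ-+ (m % d) n d ⟩
  (m % d % d + n % d) % d   ≡⟨ cong (λ r → (r + n % d) % d) (m%n%n≡m%n m d) ⟩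
  (m % d + n % d) % d       ≡⟨ %-distribˡ-+ m n d ⟨
  (m + n) % d               ∎
  where open ≡-Reasoning

[m+n%d]%d≡[m+n]%d : ∀ m n d .{{_ : NonZero d}} → (m + n % d) % d ≡ (m + n) % d
[m+n%d]%d≡[m+n]%d m n d = begin
  (m + n % d) % d   ≡⟨ cong (_% d) (+-comm m (n % d)) ⟩
  (n % d + m) % d   ≡⟨ [m%d+n]%d≡[m+n]%d n m d ⟩
  (n + m) % d       ≡⟨ cong (_% d) (+-comm n m) ⟩
  (m + n) % d       ∎
  where open ≡-Reasoning

[m+d]%n≡m%n⇒d≡0 : ∀ m d n .{{_ : NonZero n}} → d < n → (m + d) % n ≡ m % n → d ≡ 0
[m+d]%n≡m%n⇒d≡0 m d n d<n eq with m % n + d <? n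
... | yes r+d<n =
  +-cancelˡ-≡ r d 0 (trans (sym (m<n⇒m%n≡m r+d<n)) (trans r+d≡r (sym (+-identityʳ r))))
  where
  r : ℕ
  r = m % n
  r+d≡r : (r + d) % n ≡ r
  r+d≡r = trans ([m%d+n]%d≡[m+n]%d m d n) eq
... | no r+d≮n = contradiction (+-cancelˡ-≡ r d n r+d≡r+n) (<⇒≢ d<n)
  where
  r : ℕ
  r = m % n
  n≤r+d : n ≤ r + d
  n≤r+d = ≮⇒≥ r+d≮n
  once-round : r + d ∸ n ≡ r
  once-round = trans (sym (m<n⇒m%n≡m (m<n+o⇒m∸n<o (r + d) n (+-mono-< (m%n<n m n) d<n))))
                     (trans (m≤n⇒[n∸m]%m≡n%m n≤r+d) (trans ([m%d+n]%d≡[m+n]%d m d n) eq))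
  r+d≡r+n : r + d ≡ r + n
  r+d≡r+n = trans (sym (m∸n+n≡m n≤r+d)) (cong (_+ n) once-round)

%-window-injective-≤ : ∀ {u u′ s N} .{{_ : NonZero N}} → u ≤ u′ → u′ < N →
                       (u + s) % N ≡ (u′ + s) % N → u ≡ u′
%-window-injective-≤ {u} {s = s} {N} u≤u′ u′<N eq with m≤n⇒∃[o]m+o≡n u≤u′
... | d , refl = sym (trans (cong (u +_) d≡0) (+-identityʳ u))
  where
  shift : u + d + s ≡ u + s + d
  shift = trans (+-assoc u d s) (trans (cong (u +_) (+-comm d s)) (sym (+-assoc u s d)))
  d≡0 : d ≡ 0
  d≡0 = [m+d]%n≡m%n⇒d≡0 (u + s) d N (≤-<-trans (m≤n+m d u) u′<N)
                        (trans (cong (_% N) (sym shift)) (sym eq))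

%-window-injective : ∀ {u u′ s N} .{{_ : NonZero N}} → u < N → u′ < N →
                     (u + s) % N ≡ (u′ + s) % N → u ≡ u′
%-window-injective {u} {u′} u<N u′<N eq with ≤-total u u′
... | inj₁ u≤u′ = %-window-injective-≤ u≤u′ u′<N eq
... | inj₂ u′≤u = sym (%-window-injective-≤ u′≤u u<N (sym eq))

mod-cong : ∀ w w′ {N} .{{_ : NonZero N}} → w % N ≡ w′ % N → w mod N ≡ w′ mod N
mod-cong w w′ eq = fromℕ<-cong _ _ eq _ _

mod-periodic : ∀ w c N .{{_ : NonZero N}} → (w + c * N) mod N ≡ w mod N
mod-periodic w c N = mod-cong (w + c * N) w ([m+kn]%n≡m%n w c N)

toℕ-mod : ∀ {N} .{{_ : NonZero N}} (i : Fin N) → toℕ i mod N ≡ i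
toℕ-mod i = trans (fromℕ<-cong _ _ (m<n⇒m%n≡m (toℕ<n i)) _ (toℕ<n i)) (fromℕ<-toℕ i _)

mod-window-injective : ∀ {u u′ s N} .{{_ : NonZero N}} → u < N → u′ < N →
                       (u + s) mod N ≡ (u′ + s) mod N → u ≡ u′
mod-window-injective u<N u′<N eq =
  %-window-injective u<N u′<N (trans (sym (toℕ-fromℕ< _)) (trans (cong toℕ eq) (toℕ-fromℕ< _)))

sucMod-mod : ∀ k w → sucMod (w mod suc k) ≡ suc w mod suc k
sucMod-mod k w = mod-cong (suc (toℕ (w mod suc k))) (suc w)
  (trans (cong (λ r → suc r % suc k) (toℕ-fromℕ< _)) ([m+n%d]%d≡[m+n]%d 1 w (suc k)))

predMod-mod : ∀ k w → predMod (suc w mod suc k) ≡ w mod suc k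
predMod-mod k w = mod-cong (toℕ (suc w mod suc k) + k) w (begin
  (toℕ (suc w mod suc k) + k) % suc k  ≡⟨ cong (λ r → (r + k) % suc k) (toℕ-fromℕ< (m%n<n (suc w) (suc k))) ⟩
  (suc w % suc k + k) % suc k          ≡⟨ [m%d+n]%d≡[m+n]%d (suc w) k (suc k) ⟩
  (suc w + k) % suc k                  ≡⟨ cong (_% suc k) (sym (+-suc w k)) ⟩
  (w + suc k) % suc k                  ≡⟨ [m+n]%n≡m%n w (suc k) ⟩
  w % suc k                            ∎)
  where open ≡-Reasoning

length-range : ∀ {n m t} → suc n ≤ t → t ≤ n + m → ∃ λ Q → Q < m × n + suc Q ≡ t
length-range {n} {m} {t} n<t t≤n+m =
  t ∸ suc n , +-cancelˡ-≤ n (suc (t ∸ suc n)) m (subst (_≤ n + m) (sym n+1+Q≡t) t≤n+m) , n+1+Q≡t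
  where
  n+1+Q≡t : n + suc (t ∸ suc n) ≡ t
  n+1+Q≡t = trans (+-suc n _) (m+[n∸m]≡n n<t)

-- Two Hamiltonian cycles, indexed by ℕ modulo n and m

module TwoCycles (n′ m′ : ℕ) where

  n m : ℕ
  n = suc n′
  m = suc m′

  V : Set
  V = Fin n ⊎ Fin m

  x y : ℕ → V
  x w = inj₁ (w mod n)
  y w = inj₂ (w mod m)

  x-toℕ : ∀ i → x (toℕ i) ≡ inj₁ i
  x-toℕ i = cong inj₁ (toℕ-mod i)

  y-toℕ : ∀ j → y (toℕ j) ≡ inj₂ j
  y-toℕ j = cong inj₂ (toℕ-mod j)

  x-periodic : ∀ w c → x (w + c * n) ≡ x w
  x-periodic w c = cong inj₁ (mod-periodic w c n)

  y-periodic : ∀ w c → y (w + c * m) ≡ y w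
  y-periodic w c = cong inj₂ (mod-periodic w c m)

  x-window-injective : ∀ {u u′ s} → u < n → u′ < n → x (u + s) ≡ x (u′ + s) → u ≡ u′
  x-window-injective u<n u′<n = mod-window-injective u<n u′<n ∘ inj₁-injective

  y-window-injective : ∀ {u u′ s} → u < m → u′ < m → y (u + s) ≡ y (u′ + s) → u ≡ u′
  y-window-injective u<m u′<m = mod-window-injective u<m u′<m ∘ inj₂-injective

  private
    rotation : ∀ k w s → w + k * s + s ≡ w + s * suc k
    rotation = solve-∀

  x-rotate : ∀ w s → ∃ λ d → x (d + s) ≡ x w
  x-rotate w s = w + n′ * s , trans (cong x (rotation n′ w s)) (x-periodic w s)

  y-rotate : ∀ w r → ∃ λ d → y (d + r) ≡ y w
  y-rotate w r = w + m′ * r , trans (cong y (rotation m′ w r)) (y-periodic w r)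

  module _ {A : V → V → Set} (gen-sum : GenSum A) (no-good-pair : ¬ GoodPair A) where

    private
      good-pair : ∀ {s r} → A (x s) (y (suc r)) → A (y r) (x (suc s)) → GoodPair A
      good-pair {s} {r} xy yx = s mod n , suc r mod m , xy ,
        subst₂ (λ j i → A (inj₂ j) (inj₁ i)) (sym (predMod-mod m′ r)) (sym (sucMod-mod n′ s)) yx

    xy-step : ∀ {s r} → A (x s) (y (suc r)) → A (x (suc s)) (y r)
    xy-step {s} {r} xy with proj₁ (gen-sum (suc s mod n) (r mod m))
    ... | inj₁ xy′ = xy′
    ... | inj₂ yx = ⊥-elim (no-good-pair (good-pair xy yx))

    yx-step : ∀ {r s} → A (y r) (x (suc s)) → A (y (suc r)) (x s)
    yx-step {r} {s} yx with proj₁ (gen-sum (s mod n) (suc r mod m))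
    ... | inj₁ xy = ⊥-elim (no-good-pair (good-pair xy yx))
    ... | inj₂ yx′ = yx′

  module Detours {A : V → V → Set} (x-cycle : HamCycle₁ A) (y-cycle : HamCycle₂ A) (gen-sum : GenSum A)
                 (xy-step : ∀ {s r} → A (x s) (y (suc r)) → A (x (suc s)) (y r))
                 (yx-step : ∀ {r s} → A (y r) (x (suc s)) → A (y (suc r)) (x s)) where

    x-arc : ∀ w → A (x w) (x (suc w))
    x-arc w = subst (A (x w) ∘ inj₁) (sucMod-mod n′ w) (x-cycle (w mod n))

    y-arc : ∀ w → A (y w) (y (suc w))
    y-arc w = subst (A (y w) ∘ inj₂) (sucMod-mod m′ w) (y-cycle (w mod m))

    yx-steps : ∀ k {r s} → A (y r) (x (k + s)) → A (y (k + r)) (x s)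
    yx-steps zero yx = yx
    yx-steps (suc k) {r} {s} yx = yx-step (yx-steps k (subst (A (y r) ∘ x) (sym (+-suc k s)) yx))

    -- n m − 1 further steps return to the same residues modulo n and m
    yx-unstep : ∀ {r s} → A (y (suc r)) (x s) → A (y r) (x (suc s))
    yx-unstep {r} {s} yx =
      subst (λ v → A v (x (suc s))) (trans (cong y (around-y n′ m′ r)) (y-periodic r n))
        (yx-steps (m′ + n′ * m)
          (subst (A (y (suc r))) (sym (trans (cong x (around-x n′ m′ s)) (x-periodic s m))) yx))
      where
      around-y : ∀ n′ m′ w → m′ + n′ * suc m′ + suc w ≡ w + suc n′ * suc m′
      around-y = solve-∀
      around-x : ∀ n′ m′ w → m′ + n′ * suc m′ + suc w ≡ w + suc m′ * suc n′
      around-x = solve-∀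

    record Detour (s r : ℕ) : Set where
      constructor detour
      field
        enter : A (x s) (y r)
        leave : A (y r) (x (suc s))

    open Detour

    detour-resp-y : ∀ {s r r′} → y r ≡ y r′ → Detour s r → Detour s r′
    detour-resp-y {s} eq (detour xy yx) =
      detour (subst (A (x s)) eq xy) (subst (λ v → A v (x (suc s))) eq yx)

    detour-step : ∀ {s r} → Detour s (suc r) → Detour (suc s) r
    detour-step (detour xy yx) = detour (xy-step xy) (yx-unstep yx)

    detour-steps : ∀ k {s r} → Detour s (k + r) → Detour (k + s) r
    detour-steps zero δ = δ
    detour-steps (suc k) {s} {r} δ =
      subst (λ s′ → Detour s′ r) (+-suc k s) (detour-steps k (detour-step δ))

    detour-between : ∀ d {s r} → A (x s) (y r) → A (y r) (x (d + s)) → ∃ λ s′ → Detour s′ r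
    detour-between zero {s} {r} xy yx = ⊥-elim (proj₂ (gen-sum (s mod n) (r mod m)) (xy , yx))
    detour-between (suc d) {s} {r} xy yx with proj₁ (gen-sum ((d + s) mod n) (r mod m))
    ... | inj₁ xy′ = d + s , detour xy′ yx
    ... | inj₂ yx′ = detour-between d xy yx′

    detour-exists : ∀ {s r s′ r′} → A (x s) (y r) → A (y r′) (x s′) → ∃₂ Detour
    detour-exists {s} {r} {s′} {r′} xy yx with y-rotate r r′
    ... | k , y[k+r′]≡y[r] with x-rotate s′ k
    ... | t , x[t+k]≡x[s′] with x-rotate t s
    ... | d , x[d+s]≡x[t] = (λ (s″ , δ) → s″ , r , δ) (detour-between d xy yx″)
      where
      yx′ : A (y r′) (x (k + t))
      yx′ = subst (A (y r′)) (sym (trans (cong x (+-comm k t)) x[t+k]≡x[s′])) yx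
      yx″ : A (y r) (x (d + s))
      yx″ = subst₂ A y[k+r′]≡y[r] (sym x[d+s]≡x[t]) (yx-steps k yx′)

    on-detour : ∀ {s r} → Detour s r → ∀ v → ∃₂ λ a b → Detour a b × (v ≡ x a ⊎ v ≡ y b)
    on-detour {s} {r} δ (inj₁ i) with x-rotate (toℕ i) s
    ... | k , x[k+s]≡x[i] with y-rotate r k
    ... | r′ , y[r′+k]≡y[r] =
      k + s , r′ , detour-steps k (detour-resp-y y[r]≡y[k+r′] δ) , inj₁ (sym (trans x[k+s]≡x[i] (x-toℕ i)))
      where
      y[r]≡y[k+r′] : y r ≡ y (k + r′)
      y[r]≡y[k+r′] = sym (trans (cong y (+-comm k r′)) y[r′+k]≡y[r])
    on-detour {s} {r} δ (inj₂ j) with y-rotate r (toℕ j)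
    ... | k , y[k+j]≡y[r] =
      k + s , toℕ j , detour-steps k (detour-resp-y (sym y[k+j]≡y[r]) δ) , inj₂ (sym (y-toℕ j))

    -- y_b → x_{a+1} = x_{a+1+l n}, moved l n steps
    return-arc : ∀ {a b} → Detour a b → ∀ l → A (y (l * n + b)) (x (suc a))
    return-arc {a} {b} δ l = yx-steps (l * n) (subst (A (y b)) (sym x[ln+a+1]≡x[a+1]) (leave δ))
      where
      x[ln+a+1]≡x[a+1] : x (l * n + suc a) ≡ x (suc a)
      x[ln+a+1]≡x[a+1] = trans (cong x (+-comm (l * n) (suc a))) (x-periodic (suc a) l)

    -- y_b → ⋯ → y_{b+j} → x_{a+1} → y_{b−1} → x_{a+2} → ⋯ → y_{b−p} → x_{a+p+1} → ⋯ → x_{a+n} = x_a → y_b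
    -- with b = p + c
    module DetourCycle (a p c j e : ℕ) (δ : Detour a (p + c)) (ret : A (y (j + (p + c))) (x (suc a)))
                       (p+e≡n′ : p + e ≡ n′) (j+p<m : j + p < m) where

      b : ℕ
      b = p + c

      wrap : x (e + suc (p + a)) ≡ x a
      wrap = trans (cong x (trans (arith a p e) (cong (λ z → a + 1 * suc z) p+e≡n′))) (x-periodic a 1)
        where
        arith : ∀ a p e → e + suc (p + a) ≡ a + 1 * suc (p + e)
        arith = solve-∀

      rung : ∀ i → i < p → Detour (suc i + a) (p ∸ suc i + c)
      rung i i<p = detour-steps (suc i) (subst (Detour a) (sym i+1+[p-i-1+c]≡p+c) δ)
        where
        i+1+[p-i-1+c]≡p+c : suc i + (p ∸ suc i + c) ≡ p + c
        i+1+[p-i-1+c]≡p+c = trans (sym (+-assoc (suc i) (p ∸ suc i) c)) (cong (_+ c) (m+[n∸m]≡n i<p))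

      fy fx : ℕ → V
      fy i = y (i + b)
      fx l = x (l + suc (p + a))

      up-y : Star A (y b) (x (suc a))
      up-y = along fy (λ i → y-arc (i + b)) j ret

      zigzag : Star A (x (suc a)) (x (suc p + a))
      zigzag = ladder (λ i → x (suc i + a)) (λ i → y (p ∸ suc i + c)) p
                      (λ i → enter ∘ rung i) (λ i → leave ∘ rung i)

      up-x : Star A (x (suc p + a)) (y b)
      up-x = along fx (λ l → x-arc (l + suc (p + a))) e
                   (subst (λ v → A v (y b)) (sym wrap) (enter δ))

      W : Star A (y b) (y b)
      W = up-y ◅◅ zigzag ◅◅ up-x

      ys zs xs : List V
      ys = applyUpTo fy (suc j)
      zs = verts zigzag
      xs = applyUpTo fx (suc e)

      verts-W : verts W ≡ ys ++ zs ++ xs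
      verts-W = trans (verts-◅◅ up-y _) (cong₂ _++_ (verts-along _ _ j ret)
                  (trans (verts-◅◅ zigzag up-x) (cong (zs ++_) (verts-along _ _ e _))))

      p≤n′ : p ≤ n′
      p≤n′ = subst (p ≤_) p+e≡n′ (m≤m+n p e)

      e≤n′ : e ≤ n′
      e≤n′ = subst (e ≤_) p+e≡n′ (m≤n+m e p)

      j<m : j < m
      j<m = ≤-<-trans (m≤m+n j p) j+p<m

      zig-y<m : ∀ {i} → i < p → p ∸ suc i < m
      zig-y<m {i} _ = ≤-<-trans (m∸n≤m p (suc i)) (≤-<-trans (m≤n+m p j) j+p<m)

      unique-ys : Unique ys
      unique-ys = applyUpTo⁺₁ fy (suc j) λ i<i′ i′≤j → <⇒≢ i<i′ ∘
        y-window-injective (<-trans i<i′ (≤-<-trans (s≤s⁻¹ i′≤j) j<m)) (≤-<-trans (s≤s⁻¹ i′≤j) j<m)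

      unique-xs : Unique xs
      unique-xs = applyUpTo⁺₁ fx (suc e) λ l<l′ l′≤e → <⇒≢ l<l′ ∘
        x-window-injective (<-trans l<l′ (l′<n l′≤e)) (l′<n l′≤e)
        where
        l′<n : ∀ {l′} → l′ < suc e → l′ < n
        l′<n l′≤e = s≤s (≤-trans (s≤s⁻¹ l′≤e) e≤n′)

      unique-zs : Unique zs
      unique-zs = ladder-unique p
        (λ i<p i′<p → suc-injective ∘ x-window-injective (s≤s (≤-trans i<p p≤n′)) (s≤s (≤-trans i′<p p≤n′)))
        (λ i<p i′<p → suc-injective ∘ ∸-cancelˡ-≡ i<p i′<p ∘ y-window-injective (zig-y<m i<p) (zig-y<m i′<p))
        (λ _ _ ())

      zs-xs-disjoint : Disjoint zs xs
      zs-xs-disjoint (v∈zs , v∈xs) with ∈-ladder⁻ p v∈zs | ∈-applyUpTo⁻ fx v∈xs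
      ... | inj₁ (i , i<p , refl) | l , l≤e , eq =
        <⇒≢ (≤-trans i<p (m≤n+m p l))
            (x-window-injective (≤-trans (≤-trans i<p p≤n′) (n≤1+n n′)) l+p<n
              (trans (cong x (+-suc i a)) (trans eq (cong x l+p+1+a≡[l+p]+1+a))))
        where
        l+p<n : l + p < n
        l+p<n = s≤s (subst (l + p ≤_) (trans (+-comm e p) p+e≡n′) (+-monoˡ-≤ p (s≤s⁻¹ l≤e)))
        l+p+1+a≡[l+p]+1+a : l + suc (p + a) ≡ l + p + suc a
        l+p+1+a≡[l+p]+1+a = trans (cong (l +_) (sym (+-suc p a))) (sym (+-assoc l p (suc a)))
      ... | inj₂ (_ , _ , refl) | _ , _ , ()

      ys-zsxs-disjoint : Disjoint ys (zs ++ xs)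
      ys-zsxs-disjoint (v∈ys , v∈zs++xs) with ∈-applyUpTo⁻ fy v∈ys | ∈-++⁻ zs v∈zs++xs
      ... | i , i≤j , refl | inj₂ v∈xs with ∈-applyUpTo⁻ fx v∈xs
      ...   | _ , _ , ()
      ys-zsxs-disjoint _ | i , i≤j , refl | inj₁ v∈zs with ∈-ladder⁻ p v∈zs
      ...   | inj₁ (_ , _ , ())
      ...   | inj₂ (i′ , i′<p , eq) =
        <⇒≢ (<-≤-trans (∸-monoʳ-< z<s i′<p) (m≤n+m p i))
          (sym (y-window-injective i+p<m (zig-y<m i′<p) (trans (cong y (+-assoc i p c)) eq)))
        where
        i+p<m : i + p < m
        i+p<m = ≤-<-trans (+-monoˡ-≤ p (s≤s⁻¹ i≤j)) j+p<m

      unique-W : Unique (verts W)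
      unique-W = subst Unique (sym verts-W)
                   (++⁺ unique-ys (++⁺ unique-zs unique-xs zs-xs-disjoint) ys-zsxs-disjoint)

      y-b∈W : y b ∈ verts W
      y-b∈W = subst (y b ∈_) (sym verts-W) (here refl)

      x-a∈W : x a ∈ verts W
      x-a∈W = subst (x a ∈_) (sym verts-W)
                (∈-++⁺ʳ ys (∈-++⁺ʳ zs (subst (_∈ xs) wrap (∈-applyUpTo⁺ fx (n<1+n e)))))

      length-W : length (verts W) ≡ n + suc (j + p)
      length-W = begin
        length (verts W)                     ≡⟨ cong length verts-W ⟩
        length (ys ++ zs ++ xs)              ≡⟨ length-++ ys ⟩
        length ys + length (zs ++ xs)        ≡⟨ cong (length ys +_) (length-++ zs) ⟩
        length ys + (length zs + length xs)  ≡⟨ cong₂ _+_ (length-applyUpTo fy (suc j))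
                                                  (cong₂ _+_ (length-ladder p) (length-applyUpTo fx (suc e))) ⟩
        suc j + ((p + p) + suc e)            ≡⟨ arith j p e ⟩
        suc (p + e) + suc (j + p)            ≡⟨ cong (λ k → suc k + suc (j + p)) p+e≡n′ ⟩
        n + suc (j + p)                      ∎
        where
        open ≡-Reasoning
        arith : ∀ j p e → suc j + ((p + p) + suc e) ≡ suc (p + e) + suc (j + p)
        arith = solve-∀

      cycle-through : ∀ {z} → z ∈ verts W → CycleThrough A (n + suc (j + p)) z
      cycle-through {z} z∈W = subst (λ t → CycleThrough A t z) length-W (closed-walk⇒cycle W unique-W z∈W)

      cycles : CycleThrough A (n + suc (j + p)) (x a) × CycleThrough A (n + suc (j + p)) (y b)
      cycles = cycle-through x-a∈W , cycle-through y-b∈W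

    -- Q = l n + p with p < n; y_b is renamed y_{p+c} so that the zigzag indices p − 1 − i + c stay in ℕ
    detour-cycles : ∀ {a b Q} → Detour a b → Q < m →
                    CycleThrough A (n + suc Q) (x a) × CycleThrough A (n + suc Q) (y b)
    detour-cycles {a} {b} {Q} δ Q<m =
      subst (λ q → CycleThrough A (n + suc q) (x a)) (sym Q≡j+p) (proj₁ cycles) ,
      subst₂ (λ q v → CycleThrough A (n + suc q) v) (sym Q≡j+p) y[p+c]≡y[b] (proj₂ cycles)
      where
      p j c : ℕ
      p = Q % n
      j = (Q / n) * n
      c = b + m′ * p
      Q≡j+p : Q ≡ j + p
      Q≡j+p = trans (m≡m%n+[m/n]*n Q n) (+-comm p j)
      y[p+c]≡y[b] : y (p + c) ≡ y b
      y[p+c]≡y[b] = trans (cong y (arith m′ b p)) (y-periodic b p)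
        where
        arith : ∀ m′ b p → p + (b + m′ * p) ≡ b + p * suc m′
        arith = solve-∀
      δ′ : Detour a (p + c)
      δ′ = detour-resp-y (sym y[p+c]≡y[b]) δ
      cycles : CycleThrough A (n + suc (j + p)) (x a) ×
               CycleThrough A (n + suc (j + p)) (y (p + c))
      cycles = DetourCycle.cycles a p c j (n′ ∸ p) δ′ (return-arc δ′ (Q / n))
                 (m+[n∸m]≡n (s≤s⁻¹ (m%n<n Q n))) (subst (_< m) Q≡j+p Q<m)

    cycles-through : (∃₂ λ i j → A (inj₁ i) (inj₂ j)) → (∃₂ λ j i → A (inj₂ j) (inj₁ i)) →
                     ∀ v {t} → suc n ≤ t → t ≤ n + m → CycleThrough A t v
    cycles-through (i , j , xy) (j′ , i′ , yx) v n<t t≤n+m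
      with detour-exists {toℕ i} {toℕ j} {toℕ i′} {toℕ j′}
             (subst₂ A (sym (x-toℕ i)) (sym (y-toℕ j)) xy)
             (subst₂ A (sym (y-toℕ j′)) (sym (x-toℕ i′)) yx)
         | length-range n<t t≤n+m
    ... | _ , _ , δ | Q , Q<m , refl with on-detour δ v
    ...   | _ , _ , δ′ , inj₁ refl = proj₁ (detour-cycles δ′ Q<m)
    ...   | _ , _ , δ′ , inj₂ refl = proj₂ (detour-cycles δ′ Q<m)

proposition3 : (n m : ℕ) → 2 ≤ n → 2 ≤ m →
    (A : Fin n ⊎ Fin m → Fin n ⊎ Fin m → Set) →
    Loopless A → HamCycle₁ A → HamCycle₂ A → GenSum A →
    Strong A → ¬ GoodPair A →
    (v : Fin n ⊎ Fin m) (t : ℕ) → (n ⊓ m) + 2 ≤ t → t ≤ n + m →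
    CycleThrough A t v
proposition3 (suc n′) (suc m′) _ _ A _ x-cycle y-cycle gen-sum strong no-good-pair v t min+2≤t t≤n+m =
  [ via-C₁ , via-C₂ ]′ (≤-total (suc n′) (suc m′))
  where
  open TwoCycles n′ m′ using (x; y; xy-step; yx-step; module Detours)
  arc₁₂ : ∃₂ λ i j → A (inj₁ i) (inj₂ j)
  arc₁₂ = path-arc₁₂ {A = A} (proj₁ (strong (inj₁ fzero) (inj₂ fzero) λ ()))
  arc₂₁ : ∃₂ λ j i → A (inj₂ j) (inj₁ i)
  arc₂₁ = path-arc₂₁ {A = A} (proj₂ (strong (inj₁ fzero) (inj₂ fzero) λ ()))
  steps₁₂ : ∀ {s r} → A (x s) (y (suc r)) → A (x (suc s)) (y r)
  steps₁₂ = xy-step {A} gen-sum no-good-pair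
  steps₂₁ : ∀ {r s} → A (y r) (x (suc s)) → A (y (suc r)) (x s)
  steps₂₁ = yx-step {A} gen-sum no-good-pair
  min<t : ∀ {k} → suc n′ ⊓ suc m′ ≡ k → suc k ≤ t
  min<t refl = ≤-trans (≤-trans (n≤1+n _) (≤-reflexive (+-comm 2 _))) min+2≤t
  via-C₁ : suc n′ ≤ suc m′ → CycleThrough A t v
  via-C₁ n≤m = Detours.cycles-through {A} x-cycle y-cycle gen-sum steps₁₂ steps₂₁ arc₁₂ arc₂₁
                 v (min<t (m≤n⇒m⊓n≡m n≤m)) t≤n+m
  via-C₂ : suc m′ ≤ suc n′ → CycleThrough A t v
  via-C₂ m≤n = swap-cycle {A = A}
    (TwoCycles.Detours.cycles-through m′ n′ {swapped A} y-cycle x-cycle (gen-sum-swap {A = A} gen-sum)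
       steps₂₁ steps₁₂ arc₂₁ arc₁₂ (swap v) (min<t (m≥n⇒m⊓n≡n m≤n)) (subst (t ≤_) (+-comm (suc n′) _) t≤n+m))
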